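{- Let $G$ be a finite abelian group with $|G|=k\geq 3$. Then the configuration set $F(G,k)=\{(g_1,\ldots,g_k)\in G^k : g_i\neq g_j \text{ for all } i\neq j\}$ is not a generating set of the group $G^k=G\times\cdots\times G$ ($k$ factors). -}

module Defs where

open import Level using (Level; _⊔_; suc)
open import Algebra.Bundles using (Group; AbelianGroup)
open import Data.Nat using (ℕ)
open import Data.Fin using (Fin)
open import Data.Product using (Σ; _×_)
open import Function.Bundles using (Bijection)
open import Relation.Binary.PropositionalEquality using (_≡_; setoid)
open import Relation.Nullary using (¬_)
import Algebra.Construct.Pointwise as Pointwise

HasOrder : ∀ {c ℓ} → AbelianGroup c ℓ → ℕ → Set (c ⊔ ℓ)
HasOrder G k = Bijection (setoid (Fin k)) (AbelianGroup.setoid G)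

module _ {c ℓ} (H : Group c ℓ) where
  open Group H

  data ⟨_⟩ {p} (S : Carrier → Set p) : Carrier → Set (c ⊔ ℓ ⊔ p) where
    gen  : ∀ {x} → S x → ⟨ S ⟩ x
    unit : ⟨ S ⟩ ε
    mul  : ∀ {x y} → ⟨ S ⟩ x → ⟨ S ⟩ y → ⟨ S ⟩ (x ∙ y)
    inv  : ∀ {x} → ⟨ S ⟩ x → ⟨ S ⟩ (x ⁻¹)
    resp : ∀ {x y} → x ≈ y → ⟨ S ⟩ x → ⟨ S ⟩ y

  Generates : ∀ {p} → (Carrier → Set p) → Set (c ⊔ ℓ ⊔ p)
  Generates S = ∀ x → ⟨ S ⟩ x

Power : ∀ {c ℓ} → AbelianGroup c ℓ → ℕ → Group c ℓ
Power G k = AbelianGroup.group (Pointwise.abelianGroup (Fin k) G)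

F : ∀ {c ℓ} (G : AbelianGroup c ℓ) (k : ℕ) → (Fin k → AbelianGroup.Carrier G) → Set ℓ
F G k g = ∀ i j → ¬ (i ≡ j) → ¬ (AbelianGroup._≈_ G (g i) (g j))

module Submission where

-- A k-tuple of pairwise distinct elements of a group of order k lists every
-- element exactly once, so its coordinate sum is the constant s = Σ_{g ∈ G} g.
-- Negating every coordinate preserves distinctness, hence s⁻¹ ≈ s and {ε, s}
-- is a subgroup of G.  Its preimage under the summation homomorphism
-- Σ : G^k → G is a subgroup of G^k containing F(G,k).  But the tuples
-- (a, ε, …, ε) have sum a, and by pigeonhole at most two of the k ≥ 3
-- elements a of G lie in {ε, s}.

open import Defs
open import Level using (_⊔_)
open import Algebra.Bundles using (Group; AbelianGroup)
open import Algebra.Morphism.Structures using (module GroupMorphisms)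
import Algebra.Properties.AbelianGroup as AbelianGroupProperties
import Algebra.Properties.CommutativeMonoid.Sum as Sum
import Algebra.Properties.Group as GroupProperties
open import Data.Empty using (⊥-elim)
open import Data.Fin using (Fin; zero; suc; punchOut)
open import Data.Fin.Permutation using (Permutation; permutation)
open import Data.Fin.Properties
  using (_≟_; any?; pigeonhole; punchOut-injective; injective⇒≤; <⇒≢)
open import Data.Nat using (ℕ; zero; suc; _<_; _≥_)
open import Data.Nat.Properties using (1+n≰n)
open import Data.Product using (∃; _,_; proj₁; proj₂)
open import Data.Sum using (_⊎_; inj₁; inj₂; [_,_])
open import Data.Vec.Functional using (_∷_; replicate)
open import Function using (_∘_; const)
open import Function.Bundles using (Bijection)
open import Function.Definitions using (Injective)
open import Relation.Binary.Bundles using (Setoid)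
open import Relation.Binary.PropositionalEquality as ≡ using (_≡_; _≢_)
open import Relation.Nullary using (¬_; yes; no)

injective⇒surjective : ∀ {n} {π : Fin n → Fin n} → Injective _≡_ _≡_ π →
                       ∀ j → ∃ λ i → π i ≡ j
injective⇒surjective {zero}  _      ()
injective⇒surjective {suc n} {π} π-inj j with any? (λ i → π i ≟ j)
... | yes hit = hit
... | no miss = ⊥-elim (1+n≰n (injective⇒≤ punchOut-π-injective))
  where
  j≢π : ∀ i → j ≢ π i
  j≢π i j≡πi = miss (i , ≡.sym j≡πi)

  punchOut-π-injective : Injective _≡_ _≡_ (λ i → punchOut (j≢π i))
  punchOut-π-injective eq = π-inj (punchOut-injective (j≢π _) (j≢π _) eq)

injective⇒permutation : ∀ {n} {π : Fin n → Fin n} → Injective _≡_ _≡_ π →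
                        Permutation n n
injective⇒permutation {π = π} π-inj =
  permutation π (proj₁ ∘ onto) (proj₂ ∘ onto) (λ i → π-inj (proj₂ (onto (π i))))
  where
  onto : ∀ j → ∃ λ i → π i ≡ j
  onto = injective⇒surjective π-inj

module _ {a ℓ} (S : Setoid a ℓ) where
  open Setoid S

  ¬injective-into-pair : ∀ {k} {f : Fin k → Carrier} → 2 < k → Injective _≡_ _≈_ f →
                         ∀ x y → ¬ (∀ i → f i ≈ x ⊎ f i ≈ y)
  ¬injective-into-pair 2<k f-inj x y cover =
    let i , j , i<j , same = pigeonhole 2<k (side ∘ cover)
    in <⇒≢ i<j (f-inj (same-side (cover i) (cover j) same))
    where
    side : ∀ {z} → z ≈ x ⊎ z ≈ y → Fin 2
    side = [ const zero , const (suc zero) ]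

    same-side : ∀ {u v} (p : u ≈ x ⊎ u ≈ y) (q : v ≈ x ⊎ v ≈ y) → side p ≡ side q → u ≈ v
    same-side (inj₁ p) (inj₁ q) _ = trans p (sym q)
    same-side (inj₂ p) (inj₂ q) _ = trans p (sym q)
    same-side (inj₁ _) (inj₂ _) ()
    same-side (inj₂ _) (inj₁ _) ()

module _ {c ℓ} (H : Group c ℓ) where
  open Group H

  record IsSubgroup {p} (P : Carrier → Set p) : Set (c ⊔ ℓ ⊔ p) where
    field
      ε-closed  : P ε
      ∙-closed  : ∀ {x y} → P x → P y → P (x ∙ y)
      ⁻¹-closed : ∀ {x} → P x → P (x ⁻¹)
      ≈-closed  : ∀ {x y} → x ≈ y → P x → P y

  ⟨⟩-least : ∀ {p q} {S : Carrier → Set p} {P : Carrier → Set q} → IsSubgroup P →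
             (∀ {x} → S x → P x) → ∀ {x} → ⟨ H ⟩ S x → P x
  ⟨⟩-least P-sub S⊆P (gen Sx)    = S⊆P Sx
  ⟨⟩-least P-sub S⊆P unit        = IsSubgroup.ε-closed P-sub
  ⟨⟩-least P-sub S⊆P (mul x y)   =
    IsSubgroup.∙-closed P-sub (⟨⟩-least P-sub S⊆P x) (⟨⟩-least P-sub S⊆P y)
  ⟨⟩-least P-sub S⊆P (inv x)     = IsSubgroup.⁻¹-closed P-sub (⟨⟩-least P-sub S⊆P x)
  ⟨⟩-least P-sub S⊆P (resp eq x) = IsSubgroup.≈-closed P-sub eq (⟨⟩-least P-sub S⊆P x)

  involution-pair-isSubgroup : ∀ {s} → s ⁻¹ ≈ s → IsSubgroup (λ x → x ≈ ε ⊎ x ≈ s)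
  involution-pair-isSubgroup {s} s⁻¹≈s = record
    { ε-closed  = inj₁ refl
    ; ∙-closed  = ∙-closed
    ; ⁻¹-closed = ⁻¹-closed
    ; ≈-closed  = λ x≈y → [ inj₁ ∘ trans (sym x≈y) , inj₂ ∘ trans (sym x≈y) ]
    }
    where
    open GroupProperties H using (ε⁻¹≈ε)

    ∙-closed : ∀ {x y} → x ≈ ε ⊎ x ≈ s → y ≈ ε ⊎ y ≈ s → x ∙ y ≈ ε ⊎ x ∙ y ≈ s
    ∙-closed (inj₁ x≈ε) (inj₁ y≈ε) = inj₁ (trans (∙-cong x≈ε y≈ε) (identityˡ ε))
    ∙-closed (inj₁ x≈ε) (inj₂ y≈s) = inj₂ (trans (∙-cong x≈ε y≈s) (identityˡ s))
    ∙-closed (inj₂ x≈s) (inj₁ y≈ε) = inj₂ (trans (∙-cong x≈s y≈ε) (identityʳ s))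
    ∙-closed (inj₂ x≈s) (inj₂ y≈s) =
      inj₁ (trans (∙-cong x≈s (trans y≈s (sym s⁻¹≈s))) (inverseʳ s))

    ⁻¹-closed : ∀ {x} → x ≈ ε ⊎ x ≈ s → x ⁻¹ ≈ ε ⊎ x ⁻¹ ≈ s
    ⁻¹-closed (inj₁ x≈ε) = inj₁ (trans (⁻¹-cong x≈ε) ε⁻¹≈ε)
    ⁻¹-closed (inj₂ x≈s) = inj₂ (trans (⁻¹-cong x≈s) s⁻¹≈s)

module _ {c₁ ℓ₁ c₂ ℓ₂} (H₁ : Group c₁ ℓ₁) (H₂ : Group c₂ ℓ₂) where
  open GroupMorphisms (Group.rawGroup H₁) (Group.rawGroup H₂)

  preimage-isSubgroup : ∀ {p} {h : Group.Carrier H₁ → Group.Carrier H₂}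
                        {P : Group.Carrier H₂ → Set p} → IsGroupHomomorphism h →
                        IsSubgroup H₂ P → IsSubgroup H₁ (P ∘ h)
  preimage-isSubgroup {h = h} h-hom P-sub = record
    { ε-closed  = ≈-closed (H₂.sym ε-homo) ε-closed
    ; ∙-closed  = λ {x} {y} Px Py → ≈-closed (H₂.sym (homo x y)) (∙-closed Px Py)
    ; ⁻¹-closed = λ {x} Px → ≈-closed (H₂.sym (⁻¹-homo x)) (⁻¹-closed Px)
    ; ≈-closed  = λ x≈y → ≈-closed (⟦⟧-cong x≈y)
    }
    where
    module H₂ = Group H₂
    open IsGroupHomomorphism h-hom
    open IsSubgroup P-sub

module _ {c ℓ} (G : AbelianGroup c ℓ) where
  open AbelianGroup G
  open Sum commutativeMonoid using (sum; sum-cong-≋; ∑-distrib-+; sum-permute; sum-replicate-zero)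

  sum-⁻¹ : ∀ {n} (f : Fin n → Carrier) → sum (λ i → f i ⁻¹) ≈ sum f ⁻¹
  sum-⁻¹ {zero}  f = sym ε⁻¹≈ε
    where open GroupProperties group using (ε⁻¹≈ε)
  sum-⁻¹ {suc n} f = trans (∙-congˡ (sum-⁻¹ (f ∘ suc))) (⁻¹-∙-comm _ _)
    where open AbelianGroupProperties G using (⁻¹-∙-comm)

  sum-isGroupHomomorphism : ∀ k →
    GroupMorphisms.IsGroupHomomorphism (Group.rawGroup (Power G k)) rawGroup sum
  sum-isGroupHomomorphism k = record
    { isMonoidHomomorphism = record
      { isMagmaHomomorphism = record
        { isRelHomomorphism = record { cong = sum-cong-≋ }
        ; homo              = ∑-distrib-+
        }
      ; ε-homo = sum-replicate-zero k
      }
    ; ⁻¹-homo = sum-⁻¹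
    }

  sum-∷-replicate-ε : ∀ {n} x → sum (x ∷ replicate n ε) ≈ x
  sum-∷-replicate-ε {n} x = trans (∙-congˡ (sum-replicate-zero n)) (identityʳ x)

  sum-reindex-injective : ∀ {n} {π : Fin n → Fin n} → Injective _≡_ _≡_ π →
                          ∀ (f : Fin n → Carrier) → sum (f ∘ π) ≈ sum f
  sum-reindex-injective π-inj f = sym (sum-permute f (injective⇒permutation π-inj))

  module _ {k} (order : HasOrder G k) where
    open Bijection order using (to; injective; surjective)

    sum-of-elements : Carrier
    sum-of-elements = sum to

    F⇒sum≈sum-of-elements : ∀ {g} → F G k g → sum g ≈ sum-of-elements
    F⇒sum≈sum-of-elements {g} distinct =
      trans (sum-cong-≋ (sym ∘ to∘index≈g)) (sum-reindex-injective index-injective to)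
      where
      index : Fin k → Fin k
      index = proj₁ ∘ surjective ∘ g

      to∘index≈g : ∀ i → to (index i) ≈ g i
      to∘index≈g i = proj₂ (surjective (g i)) ≡.refl

      index-injective : Injective _≡_ _≡_ index
      index-injective {i} {j} same with i ≟ j
      ... | yes i≡j = i≡j
      ... | no  i≢j = ⊥-elim (distinct i j i≢j
        (trans (sym (to∘index≈g i)) (trans (Bijection.cong order same) (to∘index≈g j))))

    sum-of-elements-⁻¹ : sum-of-elements ⁻¹ ≈ sum-of-elements
    sum-of-elements-⁻¹ = trans (sym (sum-⁻¹ to))
      (F⇒sum≈sum-of-elements (λ i j i≢j eq → i≢j (injective (⁻¹-injective eq))))
      where open GroupProperties group using (⁻¹-injective)

proposition2p4 : ∀ {c ℓ} (G : AbelianGroup c ℓ) (k : ℕ) → HasOrder G k → k ≥ 3 →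
    ¬ Generates (Power G k) (F G k)
proposition2p4 G zero    _     ()
proposition2p4 G (suc n) order k≥3 generates =
  ¬injective-into-pair setoid k≥3 injective ε s to-in-pair
  where
  open AbelianGroup G
  open Bijection order using (to; injective)
  open Sum commutativeMonoid using (sum)

  s : Carrier
  s = sum-of-elements G order

  pair-isSubgroup : IsSubgroup group (λ x → x ≈ ε ⊎ x ≈ s)
  pair-isSubgroup = involution-pair-isSubgroup group (sum-of-elements-⁻¹ G order)

  sum⁻¹pair-isSubgroup : IsSubgroup (Power G (suc n)) (λ x → sum x ≈ ε ⊎ sum x ≈ s)
  sum⁻¹pair-isSubgroup = preimage-isSubgroup (Power G (suc n)) group
    (sum-isGroupHomomorphism G (suc n)) pair-isSubgroup

  to-in-pair : ∀ a → to a ≈ ε ⊎ to a ≈ s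
  to-in-pair a = IsSubgroup.≈-closed pair-isSubgroup (sum-∷-replicate-ε G {n} (to a))
    (⟨⟩-least (Power G (suc n)) sum⁻¹pair-isSubgroup
      (inj₂ ∘ F⇒sum≈sum-of-elements G order) (generates (to a ∷ replicate n ε)))
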